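{- Let $F:\{0,1\}^n\times\{0,1\}^n\to\{0,1\}$ be chosen uniformly at random among all such functions. Then, with probability tending to $1$ as $n\to\infty$, $\mathsf{NM}(F)=\Omega(n)$.
   Context: $\mathsf{NM}(F)$ is the memoryless communication complexity: an $s$-bit memoryless protocol consists of functions $f_x:\{0,1\}^s\to\{0,1\}^s$ ($x\in\{0,1\}^n$, Alice) and $g_y:\{0,1\}^s\to\{0,1\}^s$ ($y\in\{0,1\}^n$, Bob). On inputs $x,y$, Alice first sends $f_x(0^s)$; thereafter whenever Bob receives $m$ he replies $g_y(m)$ and whenever Alice receives $m$ she replies $f_x(m)$. The protocol terminates as soon as a message $1^{s-1}b$ is sent, with output $b$; it computes $F$ if it terminates with output $F(x,y)$ for all $(x,y)$. $\mathsf{NM}(F)$ is the least such $s$. -}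

module Defs where

open import Data.Bool using (Bool; true; false; not; if_then_else_)
open import Data.Nat using (ℕ; zero; suc; _+_; _*_; _^_; _<_; _≤_)
open import Data.Vec using (Vec; []; _∷_; replicate)
open import Data.List using (List; length)
open import Data.List.Relation.Unary.Any using (Any)
open import Data.Product using (Σ; ∃; _×_)
open import Relation.Binary.PropositionalEquality using (_≡_; _≢_)

Input : ℕ → Set
Input n = Vec Bool n

-- s-bit messages, where s = suc k (an s-bit protocol needs s ≥ 1 so that
-- the terminating messages 1^{s-1} b make sense)
Msg : ℕ → Set
Msg k = Vec Bool (suc k)

zeros : (k : ℕ) → Msg k
zeros k = replicate (suc k) false

term : (k : ℕ) → Bool → Msg k
term zero    b = b ∷ []
term (suc k) b = true ∷ term k b

-- An s-bit memoryless protocol (s = suc k) on n-bit inputs: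
-- Alice's functions f_x and Bob's functions g_y.
record Protocol (n k : ℕ) : Set where
  field
    f : Input n → Msg k → Msg k
    g : Input n → Msg k → Msg k
open Protocol public

aliceTurn : ℕ → Bool
aliceTurn zero    = true
aliceTurn (suc i) = not (aliceTurn i)

-- the i-th message sent on inputs x, y (ignoring termination):
-- message 0 is f_x(0^s); each later message is the reply of the
-- receiving party to the previous message.
msg : ∀ {n k} → Protocol n k → Input n → Input n → ℕ → Msg k
msg {k = k} P x y zero    = f P x (zeros k)
msg         P x y (suc i) =
  (if aliceTurn (suc i) then f P x else g P y) (msg P x y i)

Computes : ∀ {n k} → Protocol n k → (Input n → Input n → Bool) → Set
Computes {n} {k} P F =
  ∀ (x y : Input n) → ∃ λ t →
    (msg P x y t ≡ term k (F x y)) ×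
    (∀ i → i < t → ∀ b → msg P x y i ≢ term k b)

HasNMProtocol : ∀ {n} → ℕ → (Input n → Input n → Bool) → Set
HasNMProtocol {n} k F = Σ (Protocol n k) λ P → Computes P F

_≗₂_ : ∀ {n} → (Input n → Input n → Bool) → (Input n → Input n → Bool) → Set
F ≗₂ G = ∀ x y → F x y ≡ G x y

numFuns : ℕ → ℕ
numFuns n = 2 ^ (2 ^ (n + n))

module Submission where

-- A counting argument.  Fix n and a message length s = suc k.  The function
-- computed by a memoryless protocol is determined by the protocol: running
-- it for a fixed number of steps (depending only on k) and reading off the
-- first terminating message gives the answer, because the configuration
-- (whose turn, last message) evolves deterministically through at most
-- 2^(s+1) values, so by the pigeonhole principle the first terminating
-- message appears within that many steps.  Hence the functions F with an
-- s-bit protocol are covered by the list of evaluations of all pairs of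
-- strategies (x ↦ f_x, y ↦ g_y), which has 2^(2·s·2^s·2^n) entries.  For
-- 4s < n this is at most 2^(2^(2n-2)) = numFuns(n)^(1/4); taking the union
-- over the fewer than n admissible values of k and multiplying by suc q ≤ n
-- still stays below numFuns(n).  So the theorem holds with c = 1/4 (d = 3)
-- and N = suc q.

open import Defs
open import Data.Bool using (Bool; true; false)
open import Data.Nat using (ℕ; zero; suc; _+_; _*_; _^_; _∸_; _≤_; _<_; z≤n; s≤s; _≤?_; _<?_)
open import Data.Nat.Properties
open import Data.Nat.Tactic.RingSolver using (solve-∀)
open import Data.Maybe using (Maybe; just; nothing; fromMaybe)
open import Data.Vec using (Vec; []; _∷_; tail)
open import Data.List using (List; []; _∷_; [_]; _++_; map; length; cartesianProductWith)
open import Data.List.Properties using (length-++; length-map)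
open import Data.List.Relation.Unary.Any using (Any; here; there; index)
import Data.List.Relation.Unary.Any as Any
open import Data.List.Relation.Unary.Any.Properties using (map⁺; ++⁺ˡ; ++⁺ʳ; cartesianProductWith⁺; lookup-index)
open import Data.List.Membership.Propositional using (_∈_)
open import Data.Fin using (toℕ)
open import Data.Fin.Properties using (pigeonhole; toℕ<n)
open import Data.Product using (∃; ∃₂; _×_; _,_)
open import Data.Sum using (inj₁; inj₂)
open import Function using (_∘_; const)
open import Relation.Nullary using (yes; no; ¬_; contradiction)
open import Relation.Binary.PropositionalEquality using (_≡_; _≢_; refl; sym; trans; cong; cong₂; subst; module ≡-Reasoning)

output : (k : ℕ) → Msg k → Maybe Bool
output zero    (b ∷ [])    = just b
output (suc k) (true ∷ v)  = output k v
output (suc k) (false ∷ v) = nothing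

output-term : ∀ k b → output k (term k b) ≡ just b
output-term zero    b = refl
output-term (suc k) b = output-term k b

output-sound : ∀ k (v : Msg k) {b} → output k v ≡ just b → v ≡ term k b
output-sound zero    (b ∷ [])    refl = refl
output-sound (suc k) (true ∷ v)  e    = cong (true ∷_) (output-sound k v e)
output-sound (suc k) (false ∷ v) ()

FirstTermination : ∀ {k} → (ℕ → Msg k) → ℕ → Bool → Set
FirstTermination {k} h t b = (h t ≡ term k b) × (∀ i → i < t → ∀ b′ → h i ≢ term k b′)

-- Scan at most `fuel` messages of h and return the bit of the first
-- terminating one (false if there is none within the fuel).
firstOutput : ∀ {k} → (ℕ → Msg k) → ℕ → Bool
firstOutput     h zero       = false
firstOutput {k} h (suc fuel) = fromMaybe (firstOutput (h ∘ suc) fuel) (output k (h 0))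

firstOutput-correct : ∀ {k} (h : ℕ → Msg k) t b → FirstTermination h t b →
  ∀ fuel → t < fuel → firstOutput h fuel ≡ b
firstOutput-correct {k} h zero b (ht , _) (suc fuel) _ =
  cong (fromMaybe _) (trans (cong (output k) ht) (output-term k b))
firstOutput-correct {k} h (suc t) b (ht , before) (suc fuel) (s≤s t<fuel)
  with output k (h 0) in eq
... | just b′ = contradiction (output-sound k (h 0) eq) (before 0 (s≤s z≤n) b′)
... | nothing = firstOutput-correct (h ∘ suc) t b
                  (ht , λ i i<t → before (suc i) (s≤s i<t)) fuel t<fuel

firstOutput-ext : ∀ {k} {h h′ : ℕ → Msg k} → (∀ i → h i ≡ h′ i) →
  ∀ fuel → firstOutput h fuel ≡ firstOutput h′ fuel
firstOutput-ext     same zero       = refl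
firstOutput-ext {k} same (suc fuel) =
  cong₂ fromMaybe (firstOutput-ext (same ∘ suc) fuel) (cong (output k) (same 0))

length-cartesianProductWith : {A B C : Set} (f : A → B → C) (xs : List A) (ys : List B) →
  length (cartesianProductWith f xs ys) ≡ length xs * length ys
length-cartesianProductWith f []       ys = refl
length-cartesianProductWith f (x ∷ xs) ys = begin
    length (map (f x) ys ++ cartesianProductWith f xs ys)
  ≡⟨ length-++ (map (f x) ys) ⟩
    length (map (f x) ys) + length (cartesianProductWith f xs ys)
  ≡⟨ cong₂ _+_ (length-map (f x) ys) (length-cartesianProductWith f xs ys) ⟩
    length ys + length xs * length ys ∎
  where open ≡-Reasoning

bits : List Bool
bits = false ∷ true ∷ []

bits-complete : ∀ b → b ∈ bits
bits-complete false = here refl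
bits-complete true  = there (here refl)

vecs : (m : ℕ) → List (Vec Bool m)
vecs zero    = [ [] ]
vecs (suc m) = cartesianProductWith _∷_ bits (vecs m)

length-vecs : ∀ m → length (vecs m) ≡ 2 ^ m
length-vecs zero    = refl
length-vecs (suc m) =
  trans (length-cartesianProductWith _∷_ bits (vecs m)) (cong (2 *_) (length-vecs m))

vecs-complete : ∀ {m} (v : Vec Bool m) → v ∈ vecs m
vecs-complete []      = here refl
vecs-complete (b ∷ v) =
  cartesianProductWith⁺ _∷_ (cong₂ _∷_) (bits-complete b) (vecs-complete v)

byFirstBit : {X : Set} {a : ℕ} → (Vec Bool a → X) → (Vec Bool a → X) → Vec Bool (suc a) → X
byFirstBit g₀ g₁ (false ∷ v) = g₀ v
byFirstBit g₀ g₁ (true ∷ v)  = g₁ v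

functions : {X : Set} (a : ℕ) → List X → List (Vec Bool a → X)
functions zero    xs = map const xs
functions (suc a) xs = cartesianProductWith byFirstBit (functions a xs) (functions a xs)

length-functions : {X : Set} (a : ℕ) (xs : List X) →
  length (functions a xs) ≡ length xs ^ (2 ^ a)
length-functions zero    xs = trans (length-map const xs) (sym (*-identityʳ (length xs)))
length-functions (suc a) xs = begin
    length (cartesianProductWith byFirstBit (functions a xs) (functions a xs))
  ≡⟨ length-cartesianProductWith byFirstBit (functions a xs) (functions a xs) ⟩
    length (functions a xs) * length (functions a xs)
  ≡⟨ cong₂ _*_ (length-functions a xs) (length-functions a xs) ⟩
    length xs ^ (2 ^ a) * length xs ^ (2 ^ a)
  ≡⟨ sym (^-distribˡ-+-* (length xs) (2 ^ a) (2 ^ a)) ⟩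
    length xs ^ (2 ^ a + 2 ^ a)
  ≡⟨ cong (λ e → length xs ^ (2 ^ a + e)) (sym (+-identityʳ (2 ^ a))) ⟩
    length xs ^ (2 ^ suc a) ∎
  where open ≡-Reasoning

functions-complete : {X : Set} {R : X → X → Set} (a : ℕ) (xs : List X) (h : Vec Bool a → X) →
  (∀ v → Any (R (h v)) xs) → Any (λ g → ∀ v → R (h v) (g v)) (functions a xs)
functions-complete zero xs h covered = map⁺ (Any.map (λ { r [] → r }) (covered []))
functions-complete {R = R} (suc a) xs h covered =
  cartesianProductWith⁺ byFirstBit
    (λ r₀ r₁ → λ { (false ∷ v) → r₀ v ; (true ∷ v) → r₁ v })
    (functions-complete {R = R} a xs (h ∘ (false ∷_)) (covered ∘ (false ∷_)))
    (functions-complete {R = R} a xs (h ∘ (true ∷_)) (covered ∘ (true ∷_)))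

IsOrbit : {S : Set} → (S → S) → (ℕ → S) → Set
IsOrbit σ h = ∀ i → h (suc i) ≡ σ (h i)

orbit-shift : {S : Set} (σ : S → S) (h : ℕ → S) → IsOrbit σ h →
  ∀ {i j} → h i ≡ h j → ∀ a → h (a + i) ≡ h (a + j)
orbit-shift σ h orbit         same zero    = same
orbit-shift σ h orbit {i} {j} same (suc a) =
  trans (orbit (a + i)) (trans (cong σ (orbit-shift σ h orbit same a)) (sym (orbit (a + j))))

sequence-repeats : {S : Set} (es : List S) → (∀ s → s ∈ es) → (h : ℕ → S) →
  ∃₂ λ i j → i < j × j ≤ length es × h i ≡ h j
sequence-repeats es complete h
  with pigeonhole (n<1+n (length es)) (λ i → index (complete (h (toℕ i))))
... | i , j , i<j , sameIndex =
  toℕ i , toℕ j , i<j , ≤-pred (toℕ<n j) ,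
  trans (lookup-index (complete (h (toℕ i))))
        (trans (cong (Data.List.lookup es) sameIndex) (sym (lookup-index (complete (h (toℕ j))))))

first-visit-bound : {S : Set} (es : List S) → (∀ s → s ∈ es) → (σ : S → S) (h : ℕ → S) →
  IsOrbit σ h → (T : S → Set) → ∀ t → T (h t) → (∀ i → i < t → ¬ T (h i)) → t ≤ length es
first-visit-bound es complete σ h orbit T t visit before
  with sequence-repeats es complete h
... | i , j , i<j , j≤ , same with t ≤? j
...   | yes t≤j = ≤-trans t≤j j≤
...   | no  t≰j = contradiction (subst T (sym revisit) visit) (before (a + i) earlier)
  where
    a = t ∸ j
    a+j≡t : a + j ≡ t
    a+j≡t = m∸n+n≡m (<⇒≤ (≰⇒> t≰j))
    revisit : h (a + i) ≡ h t
    revisit = trans (orbit-shift σ h orbit same a) (cong h a+j≡t)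
    earlier : a + i < t
    earlier = subst (a + i <_) a+j≡t (+-monoʳ-< a i<j)

-- The configuration of a protocol run after i messages: whose turn it is
-- and the current message.  It evolves by a fixed map, `nextConfig`.
config : ∀ {n k} → Protocol n k → Input n → Input n → ℕ → Vec Bool (suc (suc k))
config P x y i = aliceTurn i ∷ msg P x y i

nextConfig : ∀ {n k} → Protocol n k → Input n → Input n → Vec Bool (suc (suc k)) → Vec Bool (suc (suc k))
nextConfig P x y (false ∷ v) = true ∷ f P x v
nextConfig P x y (true ∷ v)  = false ∷ g P y v

config-orbit : ∀ {n k} (P : Protocol n k) x y → IsOrbit (nextConfig P x y) (config P x y)
config-orbit P x y i with aliceTurn i
... | false = refl
... | true  = refl

-- Number of steps within which every run of a k-bit protocol terminates.
stepBound : ℕ → ℕ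
stepBound k = suc (length (vecs (suc (suc k))))

termination-bound : ∀ {n k} (P : Protocol n k) x y t b →
  FirstTermination (msg P x y) t b → t < stepBound k
termination-bound {k = k} P x y t b (ht , before) =
  s≤s (first-visit-bound (vecs _) vecs-complete (nextConfig P x y) (config P x y)
         (config-orbit P x y)
         (λ c → tail c ≡ term k b) t ht (λ i i<t → before i i<t b))

eval : ∀ {n k} → Protocol n k → Input n → Input n → Bool
eval {k = k} P x y = firstOutput (msg P x y) (stepBound k)

eval-correct : ∀ {n k} (P : Protocol n k) F → Computes P F → F ≗₂ eval P
eval-correct P F computes x y with computes x y
... | t , first =
  sym (firstOutput-correct (msg P x y) t (F x y) first _ (termination-bound P x y t (F x y) first))

msg-ext : ∀ {n k} (P P′ : Protocol n k) → (∀ x v → f P x v ≡ f P′ x v) → (∀ y v → g P y v ≡ g P′ y v) →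
  ∀ x y i → msg P x y i ≡ msg P′ x y i
msg-ext {k = k} P P′ sameF sameG x y zero = sameF x (zeros k)
msg-ext P P′ sameF sameG x y (suc i) with aliceTurn (suc i)
... | true  = trans (sameF x _) (cong (f P′ x) (msg-ext P P′ sameF sameG x y i))
... | false = trans (sameG y _) (cong (g P′ y) (msg-ext P P′ sameF sameG x y i))

eval-ext : ∀ {n k} (P P′ : Protocol n k) → (∀ x v → f P x v ≡ f P′ x v) → (∀ y v → g P y v ≡ g P′ y v) →
  eval P ≗₂ eval P′
eval-ext {k = k} P P′ sameF sameG x y = firstOutput-ext (msg-ext P P′ sameF sameG x y) (stepBound k)

strategies : (n k : ℕ) → List (Input n → Msg k → Msg k)
strategies n k = functions n (functions (suc k) (vecs (suc k)))

strategies-complete : ∀ {n k} (φ : Input n → Msg k → Msg k) →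
  Any (λ ψ → ∀ x v → φ x v ≡ ψ x v) (strategies n k)
strategies-complete {n} {k} φ =
  functions-complete {R = λ u w → ∀ v → u v ≡ w v} n _ φ
    (λ x → functions-complete {R = _≡_} (suc k) (vecs (suc k)) (φ x) (vecs-complete ∘ φ x))

length-strategies : ∀ n k → length (strategies n k) ≡ 2 ^ (suc k * 2 ^ suc k * 2 ^ n)
length-strategies n k = begin
    length (functions n (functions (suc k) (vecs (suc k))))
  ≡⟨ length-functions n _ ⟩
    length (functions (suc k) (vecs (suc k))) ^ (2 ^ n)
  ≡⟨ cong (_^ (2 ^ n)) (length-functions (suc k) (vecs (suc k))) ⟩
    (length (vecs (suc k)) ^ (2 ^ suc k)) ^ (2 ^ n)
  ≡⟨ cong (λ ℓ → (ℓ ^ (2 ^ suc k)) ^ (2 ^ n)) (length-vecs (suc k)) ⟩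
    ((2 ^ suc k) ^ (2 ^ suc k)) ^ (2 ^ n)
  ≡⟨ cong (_^ (2 ^ n)) (^-*-assoc 2 (suc k) (2 ^ suc k)) ⟩
    (2 ^ (suc k * 2 ^ suc k)) ^ (2 ^ n)
  ≡⟨ ^-*-assoc 2 (suc k * 2 ^ suc k) (2 ^ n) ⟩
    2 ^ (suc k * 2 ^ suc k * 2 ^ n) ∎
  where open ≡-Reasoning

protocolFunctions : (n k : ℕ) → List (Input n → Input n → Bool)
protocolFunctions n k =
  cartesianProductWith (λ a b → eval (record { f = a ; g = b })) (strategies n k) (strategies n k)

protocolFunctions-complete : ∀ {n} k (F : Input n → Input n → Bool) → HasNMProtocol k F →
  Any (F ≗₂_) (protocolFunctions n k)
protocolFunctions-complete k F (P , computes) =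
  cartesianProductWith⁺ _
    (λ {a} {b} sameF sameG x y →
      trans (eval-correct P F computes x y) (eval-ext P (record { f = a ; g = b }) sameF sameG x y))
    (strategies-complete (f P)) (strategies-complete (g P))

length-protocolFunctions : ∀ n k →
  length (protocolFunctions n k) ≡ 2 ^ (suc k * 2 ^ suc k * 2 ^ n + suc k * 2 ^ suc k * 2 ^ n)
length-protocolFunctions n k = begin
    length (protocolFunctions n k)
  ≡⟨ length-cartesianProductWith _ (strategies n k) (strategies n k) ⟩
    length (strategies n k) * length (strategies n k)
  ≡⟨ cong₂ _*_ (length-strategies n k) (length-strategies n k) ⟩
    2 ^ E * 2 ^ E
  ≡⟨ sym (^-distribˡ-+-* 2 E E) ⟩
    2 ^ (E + E) ∎
  where
    open ≡-Reasoning
    E = suc k * 2 ^ suc k * 2 ^ n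

unionBelow : {A : Set} → (ℕ → List A) → ℕ → List A
unionBelow L zero    = []
unionBelow L (suc j) = L j ++ unionBelow L j

unionBelow-complete : {A : Set} {P : A → Set} (L : ℕ → List A) →
  ∀ {j k} → k < j → Any P (L k) → Any P (unionBelow L j)
unionBelow-complete L {suc j} k<j p with m≤n⇒m<n∨m≡n (≤-pred k<j)
... | inj₁ k<j′ = ++⁺ʳ (L j) (unionBelow-complete L k<j′ p)
... | inj₂ refl = ++⁺ˡ p

length-unionBelow : {A : Set} (L : ℕ → List A) (B : ℕ) → (∀ k → length (L k) ≤ B) →
  ∀ j → length (unionBelow L j) ≤ j * B
length-unionBelow L B bounded zero    = z≤n
length-unionBelow L B bounded (suc j) =
  subst (_≤ suc j * B) (sym (length-++ (L j)))
    (+-mono-≤ (bounded j) (length-unionBelow L B bounded j))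

n<2^n : ∀ n → n < 2 ^ n
n<2^n zero    = s≤s z≤n
n<2^n (suc n) = +-mono-≤ (m^n>0 2 n) (subst (suc n ≤_) (sym (+-identityʳ (2 ^ n))) (n<2^n n))

-- Q m = 2^(2m): numFuns (suc m) = 2^(4 Q m), and a k-bit protocol class
-- with 4(k+1) ≤ m computes at most 2^(Q m) functions.
Q : ℕ → ℕ
Q m = 2 ^ (m + m)

protocol-exponent-bound : ∀ m k → suc k * 4 ≤ m →
  suc k * 2 ^ suc k * 2 ^ suc m + suc k * 2 ^ suc k * 2 ^ suc m ≤ Q m
protocol-exponent-bound m k small = begin
    s * a * (2 * b) + s * a * (2 * b)
  ≡⟨ regroup s a b ⟩
    4 * (s * a) * b
  ≤⟨ *-monoˡ-≤ b (*-monoʳ-≤ 4 (*-monoˡ-≤ a (<⇒≤ (n<2^n s)))) ⟩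
    4 * (a * a) * b
  ≡⟨ cong (λ z → 4 * z * b) (sym (^-distribˡ-+-* 2 s s)) ⟩
    4 * 2 ^ (s + s) * b
  ≡⟨ cong (_* b) (four-times (2 ^ (s + s))) ⟩
    2 ^ (2 + (s + s)) * b
  ≤⟨ *-monoˡ-≤ b (^-monoʳ-≤ 2 (≤-trans (m≤m+n (2 + (s + s)) (2 * k)) (≤-trans (≤-reflexive (four-s k)) small))) ⟩
    b * b
  ≡⟨ sym (^-distribˡ-+-* 2 m m) ⟩
    Q m ∎
  where
    open ≤-Reasoning
    s = suc k
    a = 2 ^ suc k
    b = 2 ^ m
    regroup : ∀ s a b → s * a * (2 * b) + s * a * (2 * b) ≡ 4 * (s * a) * b
    regroup = solve-∀
    four-times : ∀ z → 4 * z ≡ 2 * (2 * z)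
    four-times = solve-∀
    four-s : ∀ k → 2 + (suc k + suc k) + 2 * k ≡ suc k * 4
    four-s = solve-∀

-- The final count: (suc m) choices of k, each contributing at most
-- 2^(Q m) functions, times suc q ≤ suc m, stays below 2^(4 Q m).
numFuns-suc : ∀ m → numFuns (suc m) ≡ (2 ^ Q m) ^ 4
numFuns-suc m = begin
    2 ^ (2 ^ (suc m + suc m))
  ≡⟨ cong (λ e → 2 ^ (2 ^ e)) (+-suc (suc m) m) ⟩
    2 ^ (2 * (2 * Q m))
  ≡⟨ cong (2 ^_) (four-times (Q m)) ⟩
    2 ^ (Q m * 4)
  ≡⟨ sym (^-*-assoc 2 (Q m) 4) ⟩
    (2 ^ Q m) ^ 4 ∎
  where
    open ≡-Reasoning
    four-times : ∀ z → 2 * (2 * z) ≡ z * 4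
    four-times = solve-∀

suc-m≤2^Q : ∀ m → suc m ≤ 2 ^ Q m
suc-m≤2^Q m = ≤-trans (n<2^n m) (^-monoʳ-≤ 2 (≤-trans (m≤m+n m m) (<⇒≤ (n<2^n (m + m)))))

count-bound : ∀ m {ℓ r} → ℓ ≤ suc m * 2 ^ Q m → r ≤ suc m → ℓ * r ≤ numFuns (suc m)
count-bound m {ℓ} {r} ℓ≤ r≤ = begin
    ℓ * r
  ≤⟨ *-mono-≤ ℓ≤ r≤ ⟩
    suc m * X * suc m
  ≤⟨ *-mono-≤ (*-monoˡ-≤ X (suc-m≤2^Q m)) (suc-m≤2^Q m) ⟩
    X * X * X
  ≤⟨ m≤m*n (X * X * X) X {{m^n≢0 2 (Q m)}} ⟩
    X * X * X * X
  ≡⟨ fourth-power X ⟩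
    X ^ 4
  ≡⟨ sym (numFuns-suc m) ⟩
    numFuns (suc m) ∎
  where
    open ≤-Reasoning
    X = 2 ^ Q m
    fourth-power : ∀ z → z * z * z * z ≡ z * (z * (z * (z * 1)))
    fourth-power = solve-∀

smallProtocolFunctions : (n k : ℕ) → List (Input n → Input n → Bool)
smallProtocolFunctions n k with suc k * 4 <? n
... | yes _ = protocolFunctions n k
... | no  _ = []

smallProtocolFunctions-complete : ∀ n k (F : Input n → Input n → Bool) → suc k * 4 < n →
  HasNMProtocol k F → Any (F ≗₂_) (smallProtocolFunctions n k)
smallProtocolFunctions-complete n k F small hasP with suc k * 4 <? n
... | yes _     = protocolFunctions-complete k F hasP
... | no  large = contradiction small large

length-smallProtocolFunctions : ∀ m k → length (smallProtocolFunctions (suc m) k) ≤ 2 ^ Q m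
length-smallProtocolFunctions m k with suc k * 4 <? suc m
... | yes small = subst (_≤ 2 ^ Q m) (sym (length-protocolFunctions (suc m) k))
                    (^-monoʳ-≤ 2 (protocol-exponent-bound m k (≤-pred small)))
... | no  _     = z≤n

lemma4p2 : ∃ λ (d : ℕ) → ∀ (q : ℕ) → ∃ λ (N : ℕ) → ∀ (n : ℕ) → N ≤ n →
    ∃ λ (L : List (Input n → Input n → Bool)) →
    (length L * suc q ≤ numFuns n) ×
    (∀ (F : Input n → Input n → Bool) → (∃ λ k → (suc k * suc d < n) × HasNMProtocol k F) →
    Any (λ G → F ≗₂ G) L)
lemma4p2 = 3 , λ q → suc q , λ where
  zero    ()
  (suc m) q<n →
    let L = unionBelow (smallProtocolFunctions (suc m)) (suc m) in
    L ,
    count-bound m (length-unionBelow (smallProtocolFunctions (suc m)) (2 ^ Q m) (length-smallProtocolFunctions m) (suc m)) q<n ,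
    λ F → λ { (k , small , hasP) →
      unionBelow-complete (smallProtocolFunctions (suc m))
        (≤-trans (m≤m*n (suc k) 4) (<⇒≤ small))
        (smallProtocolFunctions-complete (suc m) k F small hasP) }
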